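{- Let $\tau,\gamma$ be non-negative integers such that, for some positive integer $\lambda$, $\gamma<\lambda$, $3\gamma+4<\tau$, $2\lambda+\gamma<\tau$ and $6\lambda\le\tau$. Let $B$ be a $(\tau,\gamma)$-bottleneck on terminals $v_1,\dots,v_k$ with spine $a_1b_1a_2b_2\dots a_kb_k$, and let $\prec$ be a $(\tau+\gamma)$-balancing order of $B$. If $a_k\prec b_k$, then $a_1\prec b_1\prec a_2\prec b_2\prec\dots\prec a_k\prec b_k$ and $v_i\prec a_i$ for every $i\in[k]$. Symmetrically, if $b_k\prec a_k$, then $b_k\prec a_k\prec b_{k-1}\prec a_{k-1}\prec\dots\prec b_1\prec a_1$ and $a_i\prec v_i$ for every $i\in[k]$.
   Context: A $(\tau,\gamma)$-bottleneck on terminals $v_1,\dots,v_k$ is the edge-weighted caterpillar obtained from the path (spine) $a_1b_1a_2b_2\dots a_kb_k$ with $\omega(a_ib_i)=\tau$ for $i\in[k]$ and $\omega(b_ia_{i+1})=\gamma+1$ for $i\in[k-1]$, by adding for each $i\in[k]$ a leaf $v_i$ adjacent to $a_i$ with $\gamma+1\le\omega(v_ia_i)\le\tau-\gamma-1$; it is rooted at $b_k$. For an edge-weighted graph and a total order $\prec$ of its vertices, the left (resp. right) weight of $v$ is the sum of $\omega(uv)$ over neighbors $u\prec v$ (resp. $v\prec u$); the order is $t$-balancing if all left and right weights are at most $t$. -}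

module Defs where

open import Data.Nat using (ℕ; zero; suc; _+_; _*_; _≤_; _<_)
open import Data.Nat.Base using (_<ᵇ_)
open import Data.Fin using (Fin; toℕ)
open import Data.Fin.Properties using () renaming (_≟_ to _≟ᶠ_)
open import Data.Bool using (Bool; if_then_else_)
open import Data.List using (List; map; _++_; filterᵇ)
open import Data.Nat.ListAction using (sum)
open import Data.List using () renaming (allFin to allFinL)
open import Relation.Nullary.Decidable using (⌊_⌋)
import Data.Nat.Properties as ℕP
open import Data.Product using (_×_)

data Vtx (k : ℕ) : Set where
  a : Fin k → Vtx k
  b : Fin k → Vtx k
  v : Fin k → Vtx k

allVtx : (k : ℕ) → List (Vtx k)
allVtx k = map a (allFinL k) ++ (map b (allFinL k) ++ map v (allFinL k))

_succOf_ : {k : ℕ} → Fin k → Fin k → Bool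
j succOf i = ⌊ toℕ j ℕP.≟ suc (toℕ i) ⌋

_eqF_ : {k : ℕ} → Fin k → Fin k → Bool
i eqF j = ⌊ i ≟ᶠ j ⌋

-- Edge weights of the bottleneck; w i = ω(v_i a_i).  Non-adjacent pairs get weight 0,
-- so that sums over all vertices equal sums over neighbours.
ωB : (τ γ : ℕ) {k : ℕ} (w : Fin k → ℕ) → Vtx k → Vtx k → ℕ
ωB τ γ w (b i) (a j) = if i eqF j then τ else (if j succOf i then suc γ else 0)
ωB τ γ w (a j) (b i) = if i eqF j then τ else (if j succOf i then suc γ else 0)
ωB τ γ w (v i) (a j) = if i eqF j then w i else 0
ωB τ γ w (a j) (v i) = if i eqF j then w i else 0
ωB τ γ w _ _ = 0

-- A total order on the vertices is given by an injective position map pos : Vtx k → ℕ,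
-- with x ≺ y iff pos x < pos y.
leftWeight : (τ γ : ℕ) {k : ℕ} (w : Fin k → ℕ) (pos : Vtx k → ℕ) → Vtx k → ℕ
leftWeight τ γ {k} w pos x = sum (map (λ u → ωB τ γ w u x) (filterᵇ (λ u → pos u <ᵇ pos x) (allVtx k)))

rightWeight : (τ γ : ℕ) {k : ℕ} (w : Fin k → ℕ) (pos : Vtx k → ℕ) → Vtx k → ℕ
rightWeight τ γ {k} w pos x = sum (map (λ u → ωB τ γ w x u) (filterᵇ (λ u → pos x <ᵇ pos u) (allVtx k)))

Balancing : (t τ γ : ℕ) {k : ℕ} (w : Fin k → ℕ) (pos : Vtx k → ℕ) → Set
Balancing t τ γ {k} w pos = ∀ (x : Vtx k) → leftWeight τ γ w pos x ≤ t × rightWeight τ γ w pos x ≤ t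

{-# OPTIONS --safe #-}
-- In a (τ+γ)-balancing order no vertex has two neighbours on the same side whose edge
-- weights add up to more than τ+γ.  Spine edges a_i b_i weigh τ and every other edge more
-- than γ, so for j = i+1 the relation a_j ≺ b_j forces b_i ≺ a_j, which forces a_i ≺ b_i,
-- which in turn forces v_i ≺ a_i.  Descending induction from a_k ≺ b_k gives the first
-- claim; the second is the same argument applied to the reversed order.
module Submission where

open import Defs
open import Data.Nat using (ℕ; suc; _+_; _*_; _≤_; _<_; _<ᵇ_)
open import Data.Nat.Properties
  using (≤-refl; ≤-trans; m≤m+n; m≤n+m; +-mono-≤; +-monoʳ-<; +-comm; n<1+n; <⇒≱; <-cmp; <⇒<ᵇ; 1+n≢n)
import Data.Nat.Properties as ℕ
open import Data.Nat.ListAction using (sum)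
open import Data.Fin using (Fin; toℕ; fromℕ; suc; inject₁)
import Data.Fin.Properties as Fin
open import Data.Fin.Induction using (>-weakInduction)
open import Data.Bool using (true; T?)
open import Data.List using (_∷_; map; filterᵇ; allFin)
open import Data.List.Membership.Propositional using (_∈_)
open import Data.List.Membership.Propositional.Properties
  using (∈-map⁺; ∈-++⁺ˡ; ∈-++⁺ʳ; ∈-allFin; ∈-filter⁺)
open import Data.List.Relation.Unary.Any using (here; there)
open import Data.Product using (Σ; _×_; _,_; proj₁; proj₂)
open import Data.Sum using (_⊎_; inj₁; inj₂)
open import Function using (_∘_)
open import Function.Definitions using (Injective)
open import Level using (0ℓ)
open import Relation.Binary.Core using (Rel)
open import Relation.Binary.Definitions using (tri<; tri≈; tri>)
open import Relation.Binary.PropositionalEquality using (_≡_; _≢_; ≢-sym; refl; sym; cong; cong₂; subst)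
open import Relation.Nullary using (yes; no; contradiction)

∈⇒≤sum-map : ∀ {A : Set} (f : A → ℕ) {x xs} → x ∈ xs → f x ≤ sum (map f xs)
∈⇒≤sum-map f {xs = y ∷ ys} (here refl)  = m≤m+n (f y) (sum (map f ys))
∈⇒≤sum-map f {xs = y ∷ ys} (there x∈ys) = ≤-trans (∈⇒≤sum-map f x∈ys) (m≤n+m _ (f y))

∈-pair⇒≤sum-map : ∀ {A : Set} (f : A → ℕ) {x y xs} →
                  x ∈ xs → y ∈ xs → x ≢ y → f x + f y ≤ sum (map f xs)
∈-pair⇒≤sum-map f (here refl)  (here refl)  x≢y = contradiction refl x≢y
∈-pair⇒≤sum-map f (here refl)  (there y∈zs) x≢y = +-mono-≤ ≤-refl (∈⇒≤sum-map f y∈zs)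
∈-pair⇒≤sum-map f {x} {y} {_ ∷ zs} (there x∈zs) (here refl) x≢y =
  subst (_≤ f y + sum (map f zs)) (+-comm (f y) (f x)) (+-mono-≤ ≤-refl (∈⇒≤sum-map f x∈zs))
∈-pair⇒≤sum-map f {xs = z ∷ zs} (there x∈zs) (there y∈zs) x≢y =
  ≤-trans (∈-pair⇒≤sum-map f x∈zs y∈zs x≢y) (m≤n+m _ (f z))

injective⇒<-connex : ∀ {A : Set} {f : A → ℕ} → Injective _≡_ _≡_ f →
                     ∀ {x y} → x ≢ y → f x < f y ⊎ f y < f x
injective⇒<-connex {f = f} f-injective {x} {y} x≢y with <-cmp (f x) (f y)
... | tri< fx<fy _ _ = inj₁ fx<fy
... | tri≈ _ fx≡fy _ = contradiction (f-injective fx≡fy) x≢y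
... | tri> _ _ fy<fx = inj₂ fy<fx

∈-allVtx : ∀ {k} (x : Vtx k) → x ∈ allVtx k
∈-allVtx {k} (a i) = ∈-++⁺ˡ (∈-map⁺ a (∈-allFin i))
∈-allVtx {k} (b i) = ∈-++⁺ʳ (map a (allFin k)) (∈-++⁺ˡ (∈-map⁺ b (∈-allFin i)))
∈-allVtx {k} (v i) = ∈-++⁺ʳ (map a (allFin k)) (∈-++⁺ʳ (map b (allFin k)) (∈-map⁺ v (∈-allFin i)))

ωB-sym : ∀ τ γ {k} (w : Fin k → ℕ) x y → ωB τ γ w x y ≡ ωB τ γ w y x
ωB-sym τ γ w (a i) (a j) = refl
ωB-sym τ γ w (a i) (b j) = refl
ωB-sym τ γ w (a i) (v j) = refl
ωB-sym τ γ w (b i) (a j) = refl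
ωB-sym τ γ w (b i) (b j) = refl
ωB-sym τ γ w (b i) (v j) = refl
ωB-sym τ γ w (v i) (a j) = refl
ωB-sym τ γ w (v i) (b j) = refl
ωB-sym τ γ w (v i) (v j) = refl

module _ (τ γ : ℕ) {k : ℕ} (w : Fin k → ℕ) (pos : Vtx k → ℕ) where

  rightWeight-pair : ∀ {x u u′} → pos x < pos u → pos x < pos u′ → u ≢ u′ →
                     ωB τ γ w x u + ωB τ γ w x u′ ≤ rightWeight τ γ w pos x
  rightWeight-pair {x} x≺u x≺u′ =
    ∈-pair⇒≤sum-map (ωB τ γ w x) (member x≺u) (member x≺u′)
    where
    member : ∀ {u} → pos x < pos u → u ∈ filterᵇ (λ y → pos x <ᵇ pos y) (allVtx k)
    member {u} x≺u = ∈-filter⁺ (T? ∘ λ y → pos x <ᵇ pos y) (∈-allVtx u) (<⇒<ᵇ x≺u)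

  leftWeight-pair : ∀ {x u u′} → pos u < pos x → pos u′ < pos x → u ≢ u′ →
                    ωB τ γ w x u + ωB τ γ w x u′ ≤ leftWeight τ γ w pos x
  leftWeight-pair {x} {u} {u′} u≺x u′≺x u≢u′ =
    subst (_≤ leftWeight τ γ w pos x) (cong₂ _+_ (ωB-sym τ γ w u x) (ωB-sym τ γ w u′ x))
      (∈-pair⇒≤sum-map (λ y → ωB τ γ w y x) (member u≺x) (member u′≺x) u≢u′)
    where
    member : ∀ {u} → pos u < pos x → u ∈ filterᵇ (λ y → pos y <ᵇ pos x) (allVtx k)
    member {u} u≺x = ∈-filter⁺ (T? ∘ λ y → pos y <ᵇ pos x) (∈-allVtx u) (<⇒<ᵇ u≺x)

module _ (τ γ : ℕ) {k : ℕ} (w : Fin k → ℕ) where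

  private
    eqF-refl : (i : Fin k) → (i eqF i) ≡ true
    eqF-refl i with i Fin.≟ i
    ... | yes _  = refl
    ... | no i≢i = contradiction refl i≢i

  ωB-spine : ∀ i → ωB τ γ w (b i) (a i) ≡ τ
  ωB-spine i rewrite eqF-refl i = refl

  ωB-leaf : ∀ i → ωB τ γ w (a i) (v i) ≡ w i
  ωB-leaf i rewrite eqF-refl i = refl

  ωB-link : ∀ i j → toℕ j ≡ suc (toℕ i) → ωB τ γ w (b i) (a j) ≡ suc γ
  ωB-link i j j≡1+i with i Fin.≟ j | toℕ j ℕ.≟ suc (toℕ i)
  ... | yes refl | _          = contradiction (sym j≡1+i) 1+n≢n
  ... | no _     | yes _      = refl
  ... | no _     | no j≢1+i   = contradiction j≡1+i j≢1+i

module SpineOrder (τ γ n : ℕ) (w : Fin (suc n) → ℕ) (γ<w : ∀ i → γ < w i)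
  (_⊏_ : Rel (Vtx (suc n)) 0ℓ)
  (connex : ∀ {x y} → x ≢ y → x ⊏ y ⊎ y ⊏ x)
  (light-after : ∀ {x u u′} → x ⊏ u → x ⊏ u′ → u ≢ u′ → ωB τ γ w x u + ωB τ γ w x u′ ≤ τ + γ)
  where

  ω : Vtx (suc n) → Vtx (suc n) → ℕ
  ω = ωB τ γ w

  heavy-pair-splits : ∀ {x u u′} → u ≢ x → u ≢ u′ → τ + γ < ω x u + ω x u′ → x ⊏ u′ → u ⊏ x
  heavy-pair-splits u≢x u≢u′ heavy x⊏u′ with connex u≢x
  ... | inj₁ u⊏x = u⊏x
  ... | inj₂ x⊏u = contradiction (light-after x⊏u x⊏u′ u≢u′) (<⇒≱ heavy)

  private
    heavy-with-spine : ∀ {c} → γ < c → τ + γ < c + τ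
    heavy-with-spine {c} γ<c = subst (τ + γ <_) (+-comm τ c) (+-monoʳ-< τ γ<c)

  -- ωB (a j) (b i) and ωB (b i) (a j) unfold to the same term, so the weights below may be
  -- written in the orientation of ωB-spine and ωB-link.
  link-before : ∀ i j → toℕ j ≡ suc (toℕ i) → a j ⊏ b j → b i ⊏ a j
  link-before i j j≡1+i = heavy-pair-splits (λ ()) b≢b heavy
    where
    b≢b : b i ≢ b j
    b≢b refl = 1+n≢n (sym j≡1+i)
    heavy : τ + γ < ω (b i) (a j) + ω (b j) (a j)
    heavy rewrite ωB-link τ γ w i j j≡1+i | ωB-spine τ γ w j = heavy-with-spine (n<1+n γ)

  spine-before : ∀ i j → toℕ j ≡ suc (toℕ i) → b i ⊏ a j → a i ⊏ b i
  spine-before i j j≡1+i = heavy-pair-splits (λ ()) a≢a heavy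
    where
    a≢a : a i ≢ a j
    a≢a refl = 1+n≢n (sym j≡1+i)
    heavy : τ + γ < ω (b i) (a i) + ω (b i) (a j)
    heavy rewrite ωB-spine τ γ w i | ωB-link τ γ w i j j≡1+i = +-monoʳ-< τ (n<1+n γ)

  leaf-before : ∀ i → a i ⊏ b i → v i ⊏ a i
  leaf-before i = heavy-pair-splits (λ ()) (λ ()) heavy
    where
    heavy : τ + γ < ω (a i) (v i) + ω (b i) (a i)
    heavy rewrite ωB-leaf τ γ w i | ωB-spine τ γ w i = heavy-with-spine (γ<w i)

  spine-ordered : a (fromℕ n) ⊏ b (fromℕ n) → ∀ i → a i ⊏ b i
  spine-ordered last = >-weakInduction (λ i → a i ⊏ b i) last step
    where
    step : ∀ i → a (suc i) ⊏ b (suc i) → a (inject₁ i) ⊏ b (inject₁ i)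
    step i = spine-before _ _ j≡1+i ∘ link-before _ _ j≡1+i
      where
      j≡1+i : toℕ (suc i) ≡ suc (toℕ (inject₁ i))
      j≡1+i = cong suc (sym (Fin.toℕ-inject₁ i))

  ordered : a (fromℕ n) ⊏ b (fromℕ n) →
              (∀ i → a i ⊏ b i)
            × (∀ i j → toℕ j ≡ suc (toℕ i) → b i ⊏ a j)
            × (∀ i → v i ⊏ a i)
  ordered last =
    spine-ordered last ,
    (λ i j j≡1+i → link-before i j j≡1+i (spine-ordered last j)) ,
    (λ i → leaf-before i (spine-ordered last i))

lemma7 : (τ γ : ℕ) →
    Σ ℕ (λ λ′ → 0 < λ′ × γ < λ′ × 3 * γ + 4 < τ × 2 * λ′ + γ < τ × 6 * λ′ ≤ τ) →
    (n : ℕ) → (w : Fin (suc n) → ℕ) →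
    (∀ i → suc γ ≤ w i × w i + suc γ ≤ τ) →
    (pos : Vtx (suc n) → ℕ) → Injective _≡_ _≡_ pos →
    Balancing (τ + γ) τ γ w pos →
    ((pos (a (fromℕ n)) < pos (b (fromℕ n)) →
        (∀ i → pos (a i) < pos (b i))
      × (∀ (i j : Fin (suc n)) → toℕ j ≡ suc (toℕ i) → pos (b i) < pos (a j))
      × (∀ i → pos (v i) < pos (a i)))
    × (pos (b (fromℕ n)) < pos (a (fromℕ n)) →
        (∀ i → pos (b i) < pos (a i))
      × (∀ (i j : Fin (suc n)) → toℕ j ≡ suc (toℕ i) → pos (a j) < pos (b i))
      × (∀ i → pos (a i) < pos (v i))))
lemma7 τ γ _ n w w-bounds pos pos-injective balancing =
  SpineOrder.ordered τ γ n w γ<w _≺_ connex light-after ,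
  SpineOrder.ordered τ γ n w γ<w _≻_ (connex ∘ ≢-sym) light-before
  where
  _≺_ _≻_ : Rel (Vtx (suc n)) 0ℓ
  x ≺ y = pos x < pos y
  x ≻ y = pos y < pos x

  γ<w : ∀ i → γ < w i
  γ<w = proj₁ ∘ w-bounds

  connex : ∀ {x y} → x ≢ y → x ≺ y ⊎ y ≺ x
  connex = injective⇒<-connex pos-injective

  light-after : ∀ {x u u′} → x ≺ u → x ≺ u′ → u ≢ u′ → ωB τ γ w x u + ωB τ γ w x u′ ≤ τ + γ
  light-after {x} x≺u x≺u′ u≢u′ =
    ≤-trans (rightWeight-pair τ γ w pos x≺u x≺u′ u≢u′) (proj₂ (balancing x))

  light-before : ∀ {x u u′} → x ≻ u → x ≻ u′ → u ≢ u′ → ωB τ γ w x u + ωB τ γ w x u′ ≤ τ + γ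
  light-before {x} u≺x u′≺x u≢u′ =
    ≤-trans (leftWeight-pair τ γ w pos u≺x u′≺x u≢u′) (proj₁ (balancing x))
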